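{- Let $P$ be a finite poset, $\ell$ a positive integer, $u=v=0$ (so $P\times[\ell]^v_u=P\times[\ell]$), and $R$ a restriction function consistent with respect to $P\times[\ell]$. Then the restriction map $\sigma\mapsto\sigma|_{\Gamma(P,R)}$ is a bijection from $\mathcal A^{\hat B}(\Gamma(P,\hat R))$ onto $\mathcal A^\ell(\Gamma(P,R))$.
   Context: A restriction function $R$ maps $P$ to nonempty finite subsets of $\mathbb Z$; it is consistent w.r.t. $P\times[\ell]$ (product of $P$ with the chain $1<\cdots<\ell$) if for all $p$ and $k\in R(p)$ there is $f:P\times[\ell]\to\mathbb Z$ with $f(p_1,i)<f(p_2,i)$ for $p_1<_Pp_2$, $f(p,i_1)\le f(p,i_2)$ for $i_1\le i_2$, $f(x,i)\in R(x)$, and $f(p,i)=k$ for some $i$. $R(p)_{>k}$/$R(p)_{<k}$: smallest element of $R(p)$ above $k$/largest below $k$; $R(p)^*=R(p)\setminus\{\max R(p)\}$. $\Gamma(P,R)$: poset on $\{(p,k):k\in R(p)^*\}$ with covers $(p_1,k_1)\lessdot(p_2,k_2)$ iff (1) $p_1=p_2$ and $k_1=R(p_1)_{>k_2}$, or (2) $p_1\lessdot_Pp_2$, $k_1=R(p_1)_{<k_2}\ne\max R(p_1)$, and no $k\in R(p_2)$ with $k>k_2$ has $R(p_1)_{<k}=k_1$. $\hat R(p)=R(p)\cup\{\min\bigcup_qR(q)-\tilde h(p),\max\bigcup_qR(q)+h(p)\}$, with $h(p)$ ($\tilde h(p)$) the maximum number of elements of a chain of $P$ with top (bottom) $p$.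 Note $\Gamma(P,R)\subseteq\Gamma(P,\hat R)$ as sets. $\hat B$ is defined on $W=\{(p,\min\hat R(p)^*),(p,\max\hat R(p)^*):p\in P\}$ by $\hat B(p,\min\hat R(p)^*)=\ell-u(p)=\ell$ and $\hat B(p,\max\hat R(p)^*)=v(p)=0$; $\mathcal A^{\hat B}(\Gamma(P,\hat R))$ is the set of order-preserving $\sigma:\Gamma(P,\hat R)\to\{0,\ldots,\ell\}$ with $\sigma|_W=\hat B$. For a finite poset $Q$, $\mathcal A^\ell(Q)$ is the set of order-preserving maps $Q\to\{0,1,\ldots,\ell\}$. -}

module Defs where

open import Level using (0ℓ)
open import Data.Nat as ℕ using (ℕ; zero; suc)
open import Data.Integer as ℤ using (ℤ; +_; _+_; _-_)
open import Data.Fin using (Fin)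
import Data.Fin as Fin
open import Data.List using (List; []; _∷_; _++_; [_]; length)
open import Data.List.Membership.Propositional using (_∈_)
open import Data.List.Relation.Unary.Linked using (Linked)
open import Data.Product using (Σ; ∃; ∃-syntax; _×_; _,_)
open import Data.Sum using (_⊎_)
open import Relation.Nullary using (¬_)
open import Relation.Binary using (Rel; IsDecPartialOrder)
open import Relation.Binary.PropositionalEquality using (_≡_; _≢_)
open import Relation.Binary.Construct.Closure.ReflexiveTransitive using (Star)

record FinPoset : Set₁ where
  field
    n       : ℕ
    _≤P_    : Rel (Fin n) 0ℓ
    isDecPO : IsDecPartialOrder _≡_ _≤P_

  _<P_ : Rel (Fin n) 0ℓ
  p <P q = p ≤P q × p ≢ q

  _⋖P_ : Rel (Fin n) 0ℓ
  p ⋖P q = p <P q × ¬ (∃[ r ] (p <P r × r <P q))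

  -- chains, represented as strictly increasing lists; number of elements = length
  -- h p: maximum number of elements of a chain with top p
  IsMaxChainTop : Fin n → ℕ → Set
  IsMaxChainTop p m =
    (∃[ cs ] (Linked _<P_ (cs ++ [ p ]) × length (cs ++ [ p ]) ≡ m))
    × (∀ cs → Linked _<P_ (cs ++ [ p ]) → length (cs ++ [ p ]) ℕ.≤ m)

  IsMaxChainBot : Fin n → ℕ → Set
  IsMaxChainBot p m =
    (∃[ cs ] (Linked _<P_ (p ∷ cs) × length (p ∷ cs) ≡ m))
    × (∀ cs → Linked _<P_ (p ∷ cs) → length (p ∷ cs) ℕ.≤ m)

open FinPoset public

IsMaxOf : (ℤ → Set) → ℤ → Set
IsMaxOf S m = S m × (∀ j → S j → j ℤ.≤ m)

IsMinOf : (ℤ → Set) → ℤ → Set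
IsMinOf S m = S m × (∀ j → S j → m ℤ.≤ j)

-- Restriction functions: R p is a finite subset of ℤ, given as a list
-- (membership via _∈_; duplicates/order irrelevant).

module _ (P : FinPoset) where
  private
    N = n P

  RestrFun : Set
  RestrFun = Fin N → List ℤ

  Nonempty : RestrFun → Set
  Nonempty R = ∀ p → ∃[ k ] (k ∈ R p)

  -- consistency w.r.t. P × [ℓ]  (chain [ℓ] encoded as Fin ℓ)
  Consistent : RestrFun → ℕ → Set
  Consistent R ℓ =
    ∀ p k → k ∈ R p →
      Σ (Fin N → Fin ℓ → ℤ) λ f →
             ( (∀ p₁ p₂ (i : Fin ℓ) → _<P_ P p₁ p₂ → f p₁ i ℤ.< f p₂ i)
             × (∀ p' (i₁ i₂ : Fin ℓ) → i₁ Fin.≤ i₂ → f p' i₁ ℤ.≤ f p' i₂)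
             × (∀ x i → f x i ∈ R x)
             × (∃[ i ] (f p i ≡ k)) )

  IsAbove : RestrFun → Fin N → ℤ → ℤ → Set
  IsAbove R p j k = IsMinOf (λ x → x ∈ R p × j ℤ.< x) k

  IsBelow : RestrFun → Fin N → ℤ → ℤ → Set
  IsBelow R p j k = IsMaxOf (λ x → x ∈ R p × x ℤ.< j) k

  IsMaxR : RestrFun → Fin N → ℤ → Set
  IsMaxR R p k = IsMaxOf (λ x → x ∈ R p) k

  InStar : RestrFun → Fin N → ℤ → Set
  InStar R p k = k ∈ R p × ¬ IsMaxR R p k

  InΓ : RestrFun → Fin N × ℤ → Set
  InΓ R (p , k) = InStar R p k

  CoverΓ : RestrFun → Rel (Fin N × ℤ) 0ℓ
  CoverΓ R (p₁ , k₁) (p₂ , k₂) =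
    InΓ R (p₁ , k₁) × InΓ R (p₂ , k₂) ×
    ( (p₁ ≡ p₂ × IsAbove R p₁ k₂ k₁)
    ⊎ (_⋖P_ P p₁ p₂ × IsBelow R p₁ k₂ k₁ × ¬ IsMaxR R p₁ k₁
       × ¬ (∃[ k ] (k ∈ R p₂ × k₂ ℤ.< k × IsBelow R p₁ k k₁))) )

  _≤Γ_ : RestrFun → Rel (Fin N × ℤ) 0ℓ
  _≤Γ_ R = Star (CoverΓ R)

  -- maps Γ → {0..ℓ} are represented by total functions Fin N × ℤ → ℕ,
  -- of which only the values on Γ matter.
  -- σ ∈ 𝒜^ℓ(Γ(P,R))
  InAℓ : RestrFun → ℕ → (Fin N × ℤ → ℕ) → Set
  InAℓ R ℓ σ =
    (∀ x → InΓ R x → σ x ℕ.≤ ℓ)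
    × (∀ x y → InΓ R x → InΓ R y → _≤Γ_ R x y → σ x ℕ.≤ σ y)

  -- R̂, given m = min ⋃ R(q), M = max ⋃ R(q), h, h̃
  Rhat : RestrFun → ℤ → ℤ → (Fin N → ℕ) → (Fin N → ℕ) → RestrFun
  Rhat R m M h h̃ p = (m - + h̃ p) ∷ (M + + h p) ∷ R p

  InAB : RestrFun → ℕ → (Fin N × ℤ → ℕ) → Set
  InAB R̂ ℓ σ =
    InAℓ R̂ ℓ σ
    × (∀ p k → IsMinOf (InStar R̂ p) k → σ (p , k) ≡ ℓ)
    × (∀ p k → IsMaxOf (InStar R̂ p) k → σ (p , k) ≡ 0)

  IsMinUnion : RestrFun → ℤ → Set
  IsMinUnion R m = (∃[ q ] (m ∈ R q)) × (∀ q j → j ∈ R q → m ℤ.≤ j)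

  IsMaxUnion : RestrFun → ℤ → Set
  IsMaxUnion R M = (∃[ q ] (M ∈ R q)) × (∀ q j → j ∈ R q → j ℤ.≤ M)

-- R̂(p) adds a value below everything in ⋃ R and one above, so R̂(p)^* = {min R̂(p)} ∪ R(p)
-- and Γ(P,R̂) is Γ(P,R) together with the points (p, min R̂(p)) and (p, max R(p)), on which
-- B̂ prescribes ℓ and 0. Every cover of Γ(P,R) is a cover of Γ(P,R̂) (the heights h make the
-- new maxima increase along P), so restriction is well defined, and it is injective because
-- the new points carry fixed values. Conversely, extending τ ∈ 𝒜^ℓ(Γ(P,R)) by ℓ and 0 is
-- order preserving: by consistency, a cover of Γ(P,R̂) never leads from some (p₁, min R̂(p₁))
-- into R, nor from Γ(P,R) to some (p₂, max R(p₂)), and the remaining covers are those of Γ(P,R).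
module Submission where

open import Defs
open import Data.Nat using (ℕ; _≤_)
open import Data.Integer using (ℤ)
open import Data.Fin using (Fin)
open import Data.Product using (Σ; ∃; ∃-syntax; _×_; _,_)
open import Relation.Binary.PropositionalEquality using (_≡_)

import Data.Nat as ℕ
import Data.Nat.Properties as ℕ
import Data.Integer as ℤ
import Data.Integer.Properties as ℤ
open import Data.Product using (proj₁; proj₂)
open import Data.Sum using (inj₁; inj₂)
open import Data.Empty using (⊥-elim)
open import Data.List using (List; []; _∷_; _++_; [_])
open import Data.List.Properties using (length-++)
open import Data.List.Relation.Unary.Any using (here; there)
open import Data.List.Relation.Unary.Linked using (Linked; [-]; _∷_)
import Data.List.Relation.Unary.All as All
open import Data.List.Membership.Propositional using (_∈_)
open import Data.List.Membership.DecPropositional ℤ._≟_ using (_∈?_)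
open import Function using (_∘_; _on_)
open import Relation.Nullary using (¬_; Dec; yes; no)
open import Relation.Nullary.Decidable using (_×-dec_; ¬?)
open import Relation.Binary.PropositionalEquality using (refl; sym; trans; subst; cong)
import Relation.Binary.Construct.Closure.ReflexiveTransitive as Star

Linked-∷ʳ : ∀ {A : Set} {_~_ : A → A → Set} (xs : List A) {x y : A} →
            Linked _~_ (xs ++ [ x ]) → x ~ y → Linked _~_ ((xs ++ [ x ]) ++ [ y ])
Linked-∷ʳ []           _          x~y = x~y ∷ [-]
Linked-∷ʳ (_ ∷ [])     (r ∷ rs)   x~y = r ∷ Linked-∷ʳ [] rs x~y
Linked-∷ʳ (_ ∷ z ∷ xs) (r ∷ rs)   x~y = r ∷ Linked-∷ʳ (z ∷ xs) rs x~y

i-n<i : ∀ i n → 1 ≤ n → i ℤ.- ℤ.+ n ℤ.< i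
i-n<i i (ℕ.suc n) _ =
  subst (i ℤ.+ ℤ.-[1+ n ] ℤ.<_) (ℤ.+-identityʳ i) (ℤ.+-monoʳ-< i ℤ.-<+)

i<i+n : ∀ i n → 1 ≤ n → i ℤ.< i ℤ.+ ℤ.+ n
i<i+n i (ℕ.suc n) _ =
  subst (ℤ._< i ℤ.+ ℤ.+ ℕ.suc n) (ℤ.+-identityʳ i) (ℤ.+-monoʳ-< i (ℤ.+<+ (ℕ.s≤s ℕ.z≤n)))

module HatExtension (P : FinPoset) (R : RestrFun P)
         (m M : ℤ) (m-min : IsMinUnion P R m) (M-max : IsMaxUnion P R M)
         (h h̃ : Fin (n P) → ℕ)
         (h-height : ∀ p → IsMaxChainTop P p (h p))
         (h̃-height : ∀ p → IsMaxChainBot P p (h̃ p)) where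

  R̂ : RestrFun P
  R̂ = Rhat P R m M h h̃

  minR̂ maxR̂ : Fin (n P) → ℤ
  minR̂ p = m ℤ.- ℤ.+ h̃ p
  maxR̂ p = M ℤ.+ ℤ.+ h p

  h-positive : ∀ p → 1 ≤ h p
  h-positive p = proj₂ (h-height p) [] [-]

  h̃-positive : ∀ p → 1 ≤ h̃ p
  h̃-positive p = proj₂ (h̃-height p) [] [-]

  h-strictMono : ∀ {p₁ p₂} → _<P_ P p₁ p₂ → h p₁ ℕ.< h p₂
  h-strictMono {p₁} {p₂} p₁<p₂ with proj₁ (h-height p₁)
  ... | cs , chain , length≡h =
    subst (_≤ h p₂)
      (trans (length-++ (cs ++ [ p₁ ])) (trans (ℕ.+-comm _ 1) (cong ℕ.suc length≡h)))
      (proj₂ (h-height p₂) (cs ++ [ p₁ ]) (Linked-∷ʳ cs chain p₁<p₂))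

  m≤ : ∀ {q j} → j ∈ R q → m ℤ.≤ j
  m≤ {q} {j} = proj₂ m-min q j

  ≤M : ∀ {q j} → j ∈ R q → j ℤ.≤ M
  ≤M {q} {j} = proj₂ M-max q j

  minR̂<R : ∀ {p q j} → j ∈ R q → minR̂ p ℤ.< j
  minR̂<R {p} j∈ = ℤ.<-≤-trans (i-n<i m (h̃ p) (h̃-positive p)) (m≤ j∈)

  R<maxR̂ : ∀ {p q j} → j ∈ R q → j ℤ.< maxR̂ p
  R<maxR̂ {p} j∈ = ℤ.≤-<-trans (≤M j∈) (i<i+n M (h p) (h-positive p))

  minR̂<maxR̂ : ∀ p → minR̂ p ℤ.< maxR̂ p
  minR̂<maxR̂ p = ℤ.<-trans (minR̂<R m∈) (R<maxR̂ m∈)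
    where m∈ = proj₂ (proj₁ m-min)

  maxR̂<maxR̂ : ∀ {p₁ p₂} → _<P_ P p₁ p₂ → maxR̂ p₁ ℤ.< maxR̂ p₂
  maxR̂<maxR̂ p₁<p₂ = ℤ.+-monoʳ-< M (ℤ.+<+ (h-strictMono p₁<p₂))

  R⊆R̂ : ∀ {p k} → k ∈ R p → k ∈ R̂ p
  R⊆R̂ = there ∘ there

  maxR̂∈R̂ : ∀ {p} → maxR̂ p ∈ R̂ p
  maxR̂∈R̂ = there (here refl)

  maxR̂-isMax : ∀ p → IsMaxR P R̂ p (maxR̂ p)
  maxR̂-isMax p = maxR̂∈R̂ , λ
    { _ (here refl)         → ℤ.<⇒≤ (minR̂<maxR̂ p)
    ; _ (there (here refl)) → ℤ.≤-refl
    ; _ (there (there j∈))  → ℤ.<⇒≤ (R<maxR̂ j∈) }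

  <maxR̂⇒¬max : ∀ {p k} → k ℤ.< maxR̂ p → ¬ IsMaxR P R̂ p k
  <maxR̂⇒¬max k< (_ , ≤k) = ℤ.<⇒≱ k< (≤k _ maxR̂∈R̂)

  R⊆R̂* : ∀ {p k} → k ∈ R p → InStar P R̂ p k
  R⊆R̂* k∈ = R⊆R̂ k∈ , <maxR̂⇒¬max (R<maxR̂ k∈)

  Γ⊆Γ̂ : ∀ x → InΓ P R x → InΓ P R̂ x
  Γ⊆Γ̂ _ (k∈ , _) = R⊆R̂* k∈

  minR̂∈R̂* : ∀ p → InStar P R̂ p (minR̂ p)
  minR̂∈R̂* p = here refl , <maxR̂⇒¬max (minR̂<maxR̂ p)

  minR̂-isMin* : ∀ p → IsMinOf (InStar P R̂ p) (minR̂ p)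
  minR̂-isMin* p = minR̂∈R̂* p , λ
    { _ (here refl , _)         → ℤ.≤-refl
    ; _ (there (here refl) , _) → ℤ.<⇒≤ (minR̂<maxR̂ p)
    ; _ (there (there j∈) , _)  → ℤ.<⇒≤ (minR̂<R j∈) }

  maxR-isMax* : ∀ {p k} → k ∈ R p → IsMaxR P R p k → IsMaxOf (InStar P R̂ p) k
  maxR-isMax* {p} k∈ (_ , ≤k) = R⊆R̂* k∈ , λ
    { _ (here refl , _)           → ℤ.<⇒≤ (minR̂<R k∈)
    ; _ (there (here refl) , ¬max) → ⊥-elim (¬max (maxR̂-isMax p))
    ; j (there (there j∈) , _)    → ≤k j j∈ }

  above-R⇒R̂ : ∀ {p k₁ k₂} → k₁ ∈ R p → k₂ ∈ R p → IsAbove P R p k₂ k₁ → IsAbove P R̂ p k₂ k₁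
  above-R⇒R̂ k₁∈ k₂∈ ((_ , k₂<k₁) , least) = (R⊆R̂ k₁∈ , k₂<k₁) , λ
    { _ (here refl , k₂<)         → ⊥-elim (ℤ.<-asym k₂< (minR̂<R k₂∈))
    ; _ (there (here refl) , _)   → ℤ.<⇒≤ (R<maxR̂ k₁∈)
    ; j (there (there j∈) , k₂<j) → least j (j∈ , k₂<j) }

  above-R̂⇒R : ∀ {p k₁ k₂} → k₁ ∈ R p → IsAbove P R̂ p k₂ k₁ → IsAbove P R p k₂ k₁
  above-R̂⇒R k₁∈ ((_ , k₂<k₁) , least) =
    (k₁∈ , k₂<k₁) , λ j (j∈ , k₂<j) → least j (R⊆R̂ j∈ , k₂<j)

  below-R⇒R̂ : ∀ {p q k₁ k} → k ∈ R q → IsBelow P R p k k₁ → IsBelow P R̂ p k k₁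
  below-R⇒R̂ k∈ ((k₁∈ , k₁<k) , greatest) = (R⊆R̂ k₁∈ , k₁<k) , λ
    { _ (here refl , _)         → ℤ.<⇒≤ (minR̂<R k₁∈)
    ; _ (there (here refl) , <k) → ⊥-elim (ℤ.<-asym <k (R<maxR̂ k∈))
    ; j (there (there j∈) , j<k) → greatest j (j∈ , j<k) }

  below-R̂⇒R : ∀ {p k₁ k₂} → k₁ ∈ R p → IsBelow P R̂ p k₂ k₁ → IsBelow P R p k₂ k₁
  below-R̂⇒R k₁∈ ((_ , k₁<k₂) , greatest) =
    (k₁∈ , k₁<k₂) , λ j (j∈ , j<k₂) → greatest j (R⊆R̂ j∈ , j<k₂)

  cover-R⇒R̂ : ∀ {x y} → CoverΓ P R x y → CoverΓ P R̂ x y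
  cover-R⇒R̂ {x} {y} (gx , gy , inj₁ (refl , above)) =
    Γ⊆Γ̂ x gx , Γ⊆Γ̂ y gy , inj₁ (refl , above-R⇒R̂ (proj₁ gx) (proj₁ gy) above)
  cover-R⇒R̂ {p₁ , k₁} {p₂ , k₂} (gx , gy , inj₂ (p₁⋖p₂ , below , ¬max , no-later)) =
    Γ⊆Γ̂ _ gx , Γ⊆Γ̂ _ gy ,
    inj₂ (p₁⋖p₂ , below-R⇒R̂ (proj₁ gy) below , <maxR̂⇒¬max (R<maxR̂ (proj₁ gx)) , no-later̂)
    where
    no-later̂ : ¬ (∃[ k ] (k ∈ R̂ p₂ × k₂ ℤ.< k × IsBelow P R̂ p₁ k k₁))
    no-later̂ (_ , here refl , k₂< , _) = ℤ.<-asym k₂< (minR̂<R (proj₁ gy))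
    -- maxR̂ p₁ < maxR̂ p₂ lies strictly between k₁ and maxR̂ p₂
    no-later̂ (_ , there (here refl) , _ , (_ , greatest)) =
      ℤ.<⇒≱ (R<maxR̂ (proj₁ gx)) (greatest (maxR̂ p₁) (maxR̂∈R̂ , maxR̂<maxR̂ (proj₁ p₁⋖p₂)))
    no-later̂ (k , there (there k∈) , k₂<k , beloŵ) =
      no-later (k , k∈ , k₂<k , below-R̂⇒R (proj₁ gx) beloŵ)

  cover-R̂⇒R : ∀ {x y} → CoverΓ P R̂ x y → InΓ P R x → InΓ P R y → CoverΓ P R x y
  cover-R̂⇒R (_ , _ , inj₁ (refl , above)) gx gy =
    gx , gy , inj₁ (refl , above-R̂⇒R (proj₁ gx) above)
  cover-R̂⇒R (_ , _ , inj₂ (p₁⋖p₂ , below , _ , no-later)) gx gy =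
    gx , gy , inj₂ (p₁⋖p₂ , below-R̂⇒R (proj₁ gx) below , proj₂ gx ,
      λ (k , k∈ , k₂<k , below') → no-later (k , R⊆R̂ k∈ , k₂<k , below-R⇒R̂ k∈ below'))

  restrict-∈𝒜ℓ : ∀ ℓ σ → InAℓ P R̂ ℓ σ → InAℓ P R ℓ σ
  restrict-∈𝒜ℓ ℓ σ (bounded , monotone) =
    (λ x gx → bounded x (Γ⊆Γ̂ x gx)) ,
    λ x y gx gy x≤y → monotone x y (Γ⊆Γ̂ x gx) (Γ⊆Γ̂ y gy) (Star.map cover-R⇒R̂ x≤y)

  maxR? : ∀ p k → Dec (IsMaxR P R p k)
  maxR? p k with k ∈? R p | All.all? (ℤ._≤? k) (R p)
  ... | yes k∈ | yes ≤k  = yes (k∈ , λ _ j∈ → All.lookup ≤k j∈)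
  ... | no k∉  | _       = no (λ (k∈ , _) → k∉ k∈)
  ... | yes _  | no ≰k   = no (λ (_ , ≤k) → ≰k (All.tabulate (λ {j} → ≤k j)))

  Γ? : ∀ p k → Dec (InΓ P R (p , k))
  Γ? p k = (k ∈? R p) ×-dec ¬? (maxR? p k)

  data Γ̂-View (p : Fin (n P)) : ℤ → Set where
    at-minR̂ : Γ̂-View p (minR̂ p)
    in-Γ    : ∀ {k} → InΓ P R (p , k) → Γ̂-View p k
    at-maxR : ∀ {k} → k ∈ R p → IsMaxR P R p k → Γ̂-View p k

  view : ∀ {p k} → InStar P R̂ p k → Γ̂-View p k
  view (here refl , _) = at-minR̂
  view {p} (there (here refl) , ¬max) = ⊥-elim (¬max (maxR̂-isMax p))
  view {p} {k} (there (there k∈) , _) with maxR? p k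
  ... | yes max = at-maxR k∈ max
  ... | no ¬max = in-Γ (k∈ , ¬max)

  restrict-injective : ∀ ℓ σ τ → InAB P R̂ ℓ σ → InAB P R̂ ℓ τ →
                       (∀ x → InΓ P R x → σ x ≡ τ x) → ∀ x → InΓ P R̂ x → σ x ≡ τ x
  restrict-injective ℓ σ τ (_ , σ-min , σ-max) (_ , τ-min , τ-max) σ≡τ (p , k) gx with view gx
  ... | at-minR̂ = trans (σ-min p _ (minR̂-isMin* p)) (sym (τ-min p _ (minR̂-isMin* p)))
  ... | in-Γ g   = σ≡τ (p , k) g
  ... | at-maxR k∈ max =
    trans (σ-max p k (maxR-isMax* k∈ max)) (sym (τ-max p k (maxR-isMax* k∈ max)))

  module WithConsistency (ℓ : ℕ) (consistent : Consistent P R ℓ) where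

    -- A chain through (p₂, k₂) meets R(p₁) strictly between min R̂(p₁) and k₂.
    ¬minR̂⋖R : ∀ {p₁ p₂ k₂} → k₂ ∈ R p₂ → ¬ CoverΓ P R̂ (p₁ , minR̂ p₁) (p₂ , k₂)
    ¬minR̂⋖R k₂∈ (_ , _ , inj₁ (refl , ((_ , k₂<) , _))) = ℤ.<-asym k₂< (minR̂<R k₂∈)
    ¬minR̂⋖R {p₁} {p₂} {k₂} k₂∈ (_ , _ , inj₂ (p₁⋖p₂ , (_ , greatest) , _))
      with consistent p₂ k₂ k₂∈
    ... | f , strict , _ , f∈R , i , fi≡k₂ =
      ℤ.<⇒≱ (minR̂<R (f∈R p₁ i))
        (greatest (f p₁ i) (R⊆R̂ (f∈R p₁ i) ,
           subst (f p₁ i ℤ.<_) fi≡k₂ (strict p₁ p₂ i (proj₁ p₁⋖p₂))))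

    -- A chain through any j ∈ R(p₁) lies below max R(p₂) at p₂, so k₁ would be max R(p₁).
    ¬Γ⋖maxR : ∀ {p₁ k₁ p₂ k₂} → InΓ P R (p₁ , k₁) → IsMaxR P R p₂ k₂ →
              ¬ CoverΓ P R̂ (p₁ , k₁) (p₂ , k₂)
    ¬Γ⋖maxR (k₁∈ , _) (_ , ≤k₂) (_ , _ , inj₁ (refl , ((_ , k₂<k₁) , _))) =
      ℤ.<⇒≱ k₂<k₁ (≤k₂ _ k₁∈)
    ¬Γ⋖maxR {p₁} {k₁} {p₂} (k₁∈ , ¬max) (_ , ≤k₂) (_ , _ , inj₂ (p₁⋖p₂ , (_ , greatest) , _)) =
      ¬max (k₁∈ , ≤k₁)
      where
      ≤k₁ : ∀ j → j ∈ R p₁ → j ℤ.≤ k₁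
      ≤k₁ j j∈ with consistent p₁ j j∈
      ... | f , strict , _ , f∈R , i , fi≡j =
        greatest j (R⊆R̂ j∈ ,
          ℤ.<-≤-trans (subst (ℤ._< f p₂ i) fi≡j (strict p₁ p₂ i (proj₁ p₁⋖p₂)))
                      (≤k₂ _ (f∈R p₂ i)))

    module Extend (τ : Fin (n P) × ℤ → ℕ) (τ∈𝒜ℓ : InAℓ P R ℓ τ) where

      extend : Fin (n P) × ℤ → ℕ
      extend (p , k) with k ℤ.≟ minR̂ p | Γ? p k
      ... | yes _ | _     = ℓ
      ... | no _  | yes _ = τ (p , k)
      ... | no _  | no _  = 0

      extend-minR̂ : ∀ p → extend (p , minR̂ p) ≡ ℓ
      extend-minR̂ p with minR̂ p ℤ.≟ minR̂ p
      ... | yes _ = refl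
      ... | no ≢  = ⊥-elim (≢ refl)

      extend-Γ : ∀ p k → InΓ P R (p , k) → extend (p , k) ≡ τ (p , k)
      extend-Γ p k g with k ℤ.≟ minR̂ p | Γ? p k
      ... | yes k≡ | _     = ⊥-elim (ℤ.<-irrefl (sym k≡) (minR̂<R (proj₁ g)))
      ... | no _   | yes _ = refl
      ... | no _   | no ¬g = ⊥-elim (¬g g)

      extend-maxR : ∀ p k → k ∈ R p → IsMaxR P R p k → extend (p , k) ≡ 0
      extend-maxR p k k∈ max with k ℤ.≟ minR̂ p | Γ? p k
      ... | yes k≡ | _         = ⊥-elim (ℤ.<-irrefl (sym k≡) (minR̂<R k∈))
      ... | no _   | yes (_ , ¬max) = ⊥-elim (¬max max)
      ... | no _   | no _      = refl

      extend-≤ℓ : ∀ x → InΓ P R̂ x → extend x ≤ ℓ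
      extend-≤ℓ (p , k) gx with view gx
      ... | at-minR̂        = ℕ.≤-reflexive (extend-minR̂ p)
      ... | in-Γ g         = subst (_≤ ℓ) (sym (extend-Γ p k g)) (proj₁ τ∈𝒜ℓ (p , k) g)
      ... | at-maxR k∈ max = subst (_≤ ℓ) (sym (extend-maxR p k k∈ max)) ℕ.z≤n

      extend-monotone-⋖ : ∀ {x y} → CoverΓ P R̂ x y → extend x ≤ extend y
      extend-monotone-⋖ {p₁ , k₁} {p₂ , k₂} x⋖y@(gx , gy , _) with view gx | view gy
      ... | at-maxR k₁∈ max | _ = subst (_≤ _) (sym (extend-maxR p₁ k₁ k₁∈ max)) ℕ.z≤n
      ... | _ | at-minR̂ = subst (extend (p₁ , k₁) ≤_) (sym (extend-minR̂ p₂)) (extend-≤ℓ _ gx)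
      ... | at-minR̂ | in-Γ g₂ = ⊥-elim (¬minR̂⋖R (proj₁ g₂) x⋖y)
      ... | at-minR̂ | at-maxR k₂∈ _ = ⊥-elim (¬minR̂⋖R k₂∈ x⋖y)
      ... | in-Γ g₁ | at-maxR _ max = ⊥-elim (¬Γ⋖maxR g₁ max x⋖y)
      ... | in-Γ g₁ | in-Γ g₂
        rewrite extend-Γ p₁ k₁ g₁ | extend-Γ p₂ k₂ g₂ =
        proj₂ τ∈𝒜ℓ _ _ g₁ g₂ (Star.return (cover-R̂⇒R x⋖y g₁ g₂))

      extend-minimum : ∀ p k → IsMinOf (InStar P R̂ p) k → extend (p , k) ≡ ℓ
      extend-minimum p k (gk , least) with view gk
      ... | at-minR̂      = extend-minR̂ p
      ... | in-Γ (k∈ , _) = ⊥-elim (ℤ.<⇒≱ (minR̂<R k∈) (least _ (minR̂∈R̂* p)))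
      ... | at-maxR k∈ _ = ⊥-elim (ℤ.<⇒≱ (minR̂<R k∈) (least _ (minR̂∈R̂* p)))

      extend-maximum : Nonempty P R → ∀ p k → IsMaxOf (InStar P R̂ p) k → extend (p , k) ≡ 0
      extend-maximum nonempty p k (gk , greatest) with view gk
      ... | at-minR̂ =
        let j , j∈ = nonempty p in ⊥-elim (ℤ.<⇒≱ (minR̂<R j∈) (greatest j (R⊆R̂* j∈)))
      ... | in-Γ (k∈ , ¬max) = ⊥-elim (¬max (k∈ , λ j j∈ → greatest j (R⊆R̂* j∈)))
      ... | at-maxR k∈ max = extend-maxR p k k∈ max

      extend-∈𝒜B̂ : Nonempty P R → InAB P R̂ ℓ extend
      extend-∈𝒜B̂ nonempty =
        ( extend-≤ℓ
        , (λ _ _ _ _ → Star.fold (_≤_ on extend) (ℕ.≤-trans ∘ extend-monotone-⋖) ℕ.≤-refl) )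
        , extend-minimum , extend-maximum nonempty

    restrict-surjective : Nonempty P R → ∀ τ → InAℓ P R ℓ τ →
                          ∃[ σ ] (InAB P R̂ ℓ σ × (∀ x → InΓ P R x → σ x ≡ τ x))
    restrict-surjective nonempty τ τ∈𝒜ℓ =
      extend , extend-∈𝒜B̂ nonempty , λ (p , k) → extend-Γ p k
      where open Extend τ τ∈𝒜ℓ

proposition2p27 : (P : FinPoset) (ℓ : ℕ) → 1 ≤ ℓ →
    (R : RestrFun P) → Nonempty P R → Consistent P R ℓ →
    (m M : ℤ) → IsMinUnion P R m → IsMaxUnion P R M →
    (h h̃ : Fin (n P) → ℕ) →
    (∀ p → IsMaxChainTop P p (h p)) → (∀ p → IsMaxChainBot P p (h̃ p)) →
    let R̂ = Rhat P R m M h h̃ in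
    -- the restriction map lands in 𝒜^ℓ(Γ(P,R))
    (∀ σ → InAB P R̂ ℓ σ → InAℓ P R ℓ σ)
    -- injectivity
    × (∀ σ τ → InAB P R̂ ℓ σ → InAB P R̂ ℓ τ →
         (∀ x → InΓ P R x → σ x ≡ τ x) → ∀ x → InΓ P R̂ x → σ x ≡ τ x)
    -- surjectivity
    × (∀ τ → InAℓ P R ℓ τ →
         ∃[ σ ] (InAB P R̂ ℓ σ × (∀ x → InΓ P R x → σ x ≡ τ x)))
proposition2p27 P ℓ _ R nonempty consistent m M m-min M-max h h̃ h-height h̃-height =
    (λ σ σ∈𝒜B̂ → restrict-∈𝒜ℓ ℓ σ (proj₁ σ∈𝒜B̂))
  , restrict-injective ℓ
  , restrict-surjective nonempty
  where
  open HatExtension P R m M m-min M-max h h̃ h-height h̃-height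
  open WithConsistency ℓ consistent
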